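{- Let $K,L\leq\mathrm{Aut}(Q_n)$, and let $\pi_K:Q_n\to(Q_n)_K$, $x\mapsto x^K$, and $\pi_L:Q_n\to(Q_n)_L$, $x\mapsto x^L$, be the natural maps. (i) If $d_K\geq 5$ and $\varphi:(Q_n)_K\to(Q_n)_L$ is a graph isomorphism, then there exists $g\in\mathrm{Aut}(Q_n)$ such that $g^{ -1}Kg=L$ and $(x^K)\varphi=(x^g)^L$ for all $x\in\mathbb{F}_2^n$. (ii) If $g\in\mathrm{Aut}(Q_n)$ and $g^{ -1}Kg=L$, then there exists a graph isomorphism $\varphi:(Q_n)_K\to(Q_n)_L$ such that $(x^K)\varphi=(x^g)^L$ for all $x\in\mathbb{F}_2^n$.
   Context: The $n$-cube $Q_n$ has vertex set $\mathbb{F}_2^n$, two vectors adjacent iff their Hamming distance is $1$; $\mathrm{Aut}(Q_n)=\mathbb{F}_2^n: S_n$ (translations and coordinate permutations), acting on the right. For $K\leq\mathrm{Aut}(Q_n)$, $d_K:=\min\{d_{Q_n}(x,x^k): x\in\mathbb{F}_2^n,\ 1\neq k\in K\}$ if $K\neq 1$ and $d_K:=\infty$ if $K=1$. The normal quotient $(Q_n)_K$ is the simple graph whose vertices are the $K$-orbits $x^K$ on $\mathbb{F}_2^n$, distinct orbits adjacent iff some vertex of one is adjacent in $Q_n$ to some vertex of the other. -}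

module Defs where

open import Data.Nat using (ℕ; suc; _≤_)
open import Data.Bool using (Bool; true; false; _xor_)
open import Data.Fin using (Fin)
open import Data.Fin.Permutation using (Permutation′; _⟨$⟩ˡ_)
open import Data.Vec using (Vec; tabulate; lookup; zipWith; count)
open import Data.Bool.Properties using (T?)
open import Data.Product using (Σ; ∃; _×_)
open import Relation.Binary.PropositionalEquality using (_≡_)
open import Relation.Nullary using (¬_)
open import Function.Bundles using (_⇔_)
open import Level using (0ℓ) renaming (suc to lsuc)

V : ℕ → Set
V n = Vec Bool n

dist : ∀ {n} → V n → V n → ℕ
dist x y = count T? (zipWith _xor_ x y)

Adj : ∀ {n} → V n → V n → Set
Adj x y = dist x y ≡ 1

-- An element of Aut(Q_n) = F_2^n : S_n, given by a translation and a
-- coordinate permutation.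
record Aut (n : ℕ) : Set where
  constructor aut
  field
    trans : V n
    perm  : Permutation′ n

-- right action x ↦ x^g : first translate by t, then permute coordinates by σ
-- (coordinate i of x moves to position σ(i)).
act : ∀ {n} → Aut n → V n → V n
act (aut t σ) x = tabulate (λ i → lookup (zipWith _xor_ x t) (σ ⟨$⟩ˡ i))

-- equality of automorphisms (the action is faithful, so this is equality
-- in Aut(Q_n))
_≈_ : ∀ {n} → Aut n → Aut n → Set
g ≈ h = ∀ x → act g x ≡ act h x

record Subgroup (n : ℕ) : Set₁ where
  field
    mem      : Aut n → Set
    mem-resp : ∀ {g h} → g ≈ h → mem g → mem h
    has-id   : Σ (Aut n) λ e → mem e × (∀ x → act e x ≡ x)
    has-mul  : ∀ {a b} → mem a → mem b →
               Σ (Aut n) λ c → mem c × (∀ x → act c x ≡ act b (act a x))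
    has-inv  : ∀ {a} → mem a →
               Σ (Aut n) λ c → mem c × (∀ x → act c (act a x) ≡ x)
open Subgroup public

IsId : ∀ {n} → Aut n → Set
IsId g = ∀ x → act g x ≡ x

-- d_K ≥ m  (vacuous when K = 1, matching d_K = ∞)
dK≥ : ∀ {n} → Subgroup n → ℕ → Set
dK≥ K m = ∀ k → mem K k → ¬ IsId k → ∀ x → m ≤ dist x (act k x)

-- g⁻¹ K g = L :  h ∈ L  iff  h = g⁻¹ k g for some k ∈ K,
-- where h = g⁻¹ k g  iff  k g = g h, i.e. ∀ x, (x^k)^g = (x^g)^h.
Conj : ∀ {n} → Aut n → Subgroup n → Subgroup n → Set
Conj g K L = ∀ h → (mem L h ⇔ Σ _ λ k → mem K k × (∀ x → act g (act k x) ≡ act h (act g x)))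

_∼[_]_ : ∀ {n} → V n → Subgroup n → V n → Set
x ∼[ K ] y = Σ _ λ k → mem K k × act k x ≡ y

QAdj : ∀ {n} → Subgroup n → V n → V n → Set
QAdj K a b = ¬ (a ∼[ K ] b) ×
  Σ _ λ a' → Σ _ λ b' → a ∼[ K ] a' × b ∼[ K ] b' × Adj a' b'

-- a graph isomorphism (Q_n)_K → (Q_n)_L, given on representatives:
-- a well-defined bijection on orbits preserving and reflecting adjacency.
record QIso {n} (K L : Subgroup n) : Set where
  field
    φ    : V n → V n
    resp : ∀ {x y} → x ∼[ K ] y → φ x ∼[ L ] φ y
    inj  : ∀ {x y} → φ x ∼[ L ] φ y → x ∼[ K ] y
    surj : ∀ y → Σ _ λ x → φ x ∼[ L ] y
    adj  : ∀ x y → (QAdj K x y ⇔ QAdj L (φ x) (φ y))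
open QIso public

-- Since d_K ≥ 5, two vertices of one K-orbit at distance at most 4 coincide, so around
-- every vertex the quotient (Q_n)_K looks like Q_n: the neighbours of x^K are the n distinct
-- orbits of the neighbours of x, and squares through x^K lift to squares through x.  An
-- isomorphism φ therefore matches, at each vertex, the coordinates toggled at x with those
-- toggled at a representative of (x^K)φ, and this matching is compatible around squares.
-- Taking g in Aut(Q_n) to agree with φ at the origin and its neighbours, square-compatibility
-- propagates the agreement x^K φ = (x^g)^L along edges to all of F_2^n.  Then g carries
-- K-orbits exactly onto L-orbits, and g⁻¹Kg = L follows because an automorphism of Q_n
-- preserving every orbit of a group S in which no nontrivial element moves a vertex by
-- distance 0 or 2 lies in S (apply this to g h g⁻¹ and g⁻¹ k g; L inherits the property from K
-- by conjugation).  Part (ii) is a direct check.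

module Submission where

open import Defs
open import Data.Nat using (ℕ; zero; suc; pred; _+_; _≤_; _<_; s≤s)
open import Data.Nat.Properties using (≤-refl; ≤-trans; ≤-reflexive; n≤1+n; n<1+n; <⇒≱; m≤m+n)
open import Data.Bool using (Bool; true; false; not; _xor_)
open import Data.Bool.Properties
  using (T?; not-¬; not-involutive; not-distribˡ-xor; xor-assoc; xor-comm; xor-same; xor-identityʳ)
  renaming (_≟_ to _≟ᵇ_)
open import Data.Fin using (Fin; zero; suc)
open import Data.Fin.Properties using (any?; punchOut-injective; <⇒notInjective) renaming (_≟_ to _≟ᶠ_)
open import Data.Fin.Permutation
  using (Permutation′; permutation; _⟨$⟩ˡ_; _⟨$⟩ʳ_; inverseˡ; inverseʳ; _∘ₚ_) renaming (flip to _⁻¹ₚ)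
open import Data.Vec using ([]; _∷_; tabulate; lookup; count; replicate; updateAt)
open import Data.Vec.Properties
  using (lookup∘tabulate; tabulate∘lookup; tabulate-cong; lookup-zipWith; zipWith-comm; lookup-replicate;
         lookup∘updateAt; lookup∘updateAt′; updateAt-updateAt-local; updateAt-id; updateAt-commutes; ≡-dec)
open import Data.List using (List; []; _∷_; length; map)
open import Data.Product using (Σ; _×_; _,_; proj₁; proj₂)
open import Data.Sum using (_⊎_; inj₁; inj₂)
open import Function using (_∘_; id)
open import Function.Bundles using (_⇔_; mk⇔; Equivalence)
open import Function.Definitions using (Injective)
open import Level using (0ℓ)
open import Relation.Binary.Bundles using (Setoid)
open import Relation.Binary.PropositionalEquality
  using (_≡_; _≢_; refl; sym; trans; cong; cong₂; subst; subst₂; module ≡-Reasoning)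
open import Relation.Nullary using (Dec; yes; no; contradiction)
import Relation.Binary.Reasoning.Setoid as SetoidReasoning

private variable n : ℕ

-- Toggling coordinates

toggle : Fin n → V n → V n
toggle c x = updateAt x c not

lookup-toggle : (c : Fin n) (x : V n) → lookup (toggle c x) c ≡ not (lookup x c)
lookup-toggle c x = lookup∘updateAt c x

lookup-toggle-≢ : {c i : Fin n} (x : V n) → c ≢ i → lookup (toggle c x) i ≡ lookup x i
lookup-toggle-≢ {c = c} {i} x c≢i = lookup∘updateAt′ i c (c≢i ∘ sym) x

toggle-involutive : (c : Fin n) (x : V n) → toggle c (toggle c x) ≡ x
toggle-involutive c x =
  trans (updateAt-updateAt-local c {h = id} x (not-involutive (lookup x c))) (updateAt-id c x)

toggle-comm : (a c : Fin n) (x : V n) → toggle a (toggle c x) ≡ toggle c (toggle a x)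
toggle-comm a c x with a ≟ᶠ c
... | yes refl = refl
... | no a≢c = updateAt-commutes a c a≢c x

toggle-cancel : (c : Fin n) {x y : V n} → toggle c x ≡ toggle c y → x ≡ y
toggle-cancel c {x} {y} eq =
  trans (sym (toggle-involutive c x)) (trans (cong (toggle c) eq) (toggle-involutive c y))

toggle-≢ : (c : Fin n) (x : V n) → toggle c x ≢ x
toggle-≢ c x eq = not-¬ refl (trans (cong (λ v → lookup v c) (sym eq)) (lookup-toggle c x))

toggle-injective : {c c′ : Fin n} (x : V n) → toggle c x ≡ toggle c′ x → c ≡ c′
toggle-injective {c = c} {c′} x eq with c ≟ᶠ c′
... | yes c≡c′ = c≡c′
... | no c≢c′ = contradiction (begin
    lookup x c                 ≡⟨ lookup-toggle-≢ x (c≢c′ ∘ sym) ⟨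
    lookup (toggle c′ x) c     ≡⟨ cong (λ v → lookup v c) eq ⟨
    lookup (toggle c x) c      ≡⟨ lookup-toggle c x ⟩
    not (lookup x c)           ∎) (not-¬ refl)
  where open ≡-Reasoning

toggle-pair-cases : {c c′ r s : Fin n} (x : V n) → c ≢ c′ →
  toggle s (toggle c′ x) ≡ toggle r (toggle c x) → r ≡ c ⊎ r ≡ c′
toggle-pair-cases {c = c} {c′} {r} {s} x c≢c′ eq with r ≟ᶠ c | r ≟ᶠ c′
... | yes r≡c | _ = inj₁ r≡c
... | no _ | yes r≡c′ = inj₂ r≡c′
... | no r≢c | no r≢c′ with s ≟ᶠ r
...   | yes refl = contradiction (toggle-injective x (toggle-cancel s eq)) (c≢c′ ∘ sym)
...   | no s≢r = contradiction (begin
    lookup x r                            ≡⟨ lookup-toggle-≢ x (r≢c′ ∘ sym) ⟨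
    lookup (toggle c′ x) r                ≡⟨ lookup-toggle-≢ (toggle c′ x) s≢r ⟨
    lookup (toggle s (toggle c′ x)) r     ≡⟨ cong (λ v → lookup v r) eq ⟩
    lookup (toggle r (toggle c x)) r      ≡⟨ lookup-toggle r (toggle c x) ⟩
    not (lookup (toggle c x) r)           ≡⟨ cong not (lookup-toggle-≢ x (r≢c ∘ sym)) ⟩
    not (lookup x r)                      ∎) (not-¬ refl)
  where open ≡-Reasoning

flips : List (Fin n) → V n → V n
flips []       x = x
flips (c ∷ cs) x = toggle c (flips cs x)

origin : V n
origin = replicate _ false

flips-suc : (cs : List (Fin n)) (b : Bool) (x : V n) → flips (map suc cs) (b ∷ x) ≡ b ∷ flips cs x
flips-suc []       b x = refl
flips-suc (c ∷ cs) b x = cong (toggle (suc c)) (flips-suc cs b x)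

flips-from-origin : (x : V n) → Σ (List (Fin n)) λ cs → flips cs origin ≡ x
flips-from-origin [] = [] , refl
flips-from-origin (false ∷ x) with cs , eq ← flips-from-origin x =
  map suc cs , trans (flips-suc cs false origin) (cong (false ∷_) eq)
flips-from-origin (true ∷ x) with cs , eq ← flips-from-origin x =
  zero ∷ map suc cs , cong (toggle zero) (trans (flips-suc cs false origin) (cong (false ∷_) eq))

toggle-induction : (P : V n → Set) → P origin → (∀ c x → P x → P (toggle c x)) → ∀ x → P x
toggle-induction P p₀ step x = let cs , eq = flips-from-origin x in subst P eq (along cs)
  where
  along : ∀ cs → P (flips cs origin)
  along []       = p₀
  along (c ∷ cs) = step c _ (along cs)

dist-sym : (x y : V n) → dist x y ≡ dist y x
dist-sym x y = cong (count T?) (zipWith-comm xor-comm x y)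

dist-self : (x : V n) → dist x x ≡ 0
dist-self []          = refl
dist-self (false ∷ x) = dist-self x
dist-self (true ∷ x)  = dist-self x

dist≡0⇒≡ : (x y : V n) → dist x y ≡ 0 → x ≡ y
dist≡0⇒≡ []          []          _  = refl
dist≡0⇒≡ (false ∷ x) (false ∷ y) eq = cong (false ∷_) (dist≡0⇒≡ x y eq)
dist≡0⇒≡ (true ∷ x)  (true ∷ y)  eq = cong (true ∷_) (dist≡0⇒≡ x y eq)
dist≡0⇒≡ (false ∷ x) (true ∷ y)  ()
dist≡0⇒≡ (true ∷ x)  (false ∷ y) ()

dist-toggleʳ : (c : Fin n) (x y : V n) → dist x (toggle c y) ≤ suc (dist x y)
dist-toggleʳ zero    (false ∷ x) (false ∷ y) = ≤-refl
dist-toggleʳ zero    (false ∷ x) (true ∷ y)  = ≤-trans (n≤1+n _) (n≤1+n _)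
dist-toggleʳ zero    (true ∷ x)  (false ∷ y) = ≤-trans (n≤1+n _) (n≤1+n _)
dist-toggleʳ zero    (true ∷ x)  (true ∷ y)  = ≤-refl
dist-toggleʳ (suc c) (false ∷ x) (false ∷ y) = dist-toggleʳ c x y
dist-toggleʳ (suc c) (false ∷ x) (true ∷ y)  = s≤s (dist-toggleʳ c x y)
dist-toggleʳ (suc c) (true ∷ x)  (false ∷ y) = s≤s (dist-toggleʳ c x y)
dist-toggleʳ (suc c) (true ∷ x)  (true ∷ y)  = dist-toggleʳ c x y

dist-toggleˡ : (c : Fin n) (x y : V n) → dist (toggle c x) y ≤ suc (dist x y)
dist-toggleˡ c x y rewrite dist-sym (toggle c x) y | dist-sym x y = dist-toggleʳ c y x

dist-flips : (cs ds : List (Fin n)) (x : V n) → dist (flips cs x) (flips ds x) ≤ length cs + length ds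
dist-flips []       []       x = ≤-reflexive (dist-self x)
dist-flips []       (d ∷ ds) x = ≤-trans (dist-toggleʳ d x (flips ds x)) (s≤s (dist-flips [] ds x))
dist-flips (c ∷ cs) ds       x = ≤-trans (dist-toggleˡ c (flips cs x) (flips ds x)) (s≤s (dist-flips cs ds x))

toggle-Adj : (c : Fin n) (x : V n) → Adj x (toggle c x)
toggle-Adj zero    (false ∷ x) = cong suc (dist-self x)
toggle-Adj zero    (true ∷ x)  = cong suc (dist-self x)
toggle-Adj (suc c) (false ∷ x) = toggle-Adj c x
toggle-Adj (suc c) (true ∷ x)  = toggle-Adj c x

Adj⇒toggle : (x y : V n) → Adj x y → Σ (Fin n) λ c → y ≡ toggle c x
Adj⇒toggle [] [] ()
Adj⇒toggle (false ∷ x) (false ∷ y) eq with c , refl ← Adj⇒toggle x y eq = suc c , refl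
Adj⇒toggle (true ∷ x)  (true ∷ y)  eq with c , refl ← Adj⇒toggle x y eq = suc c , refl
Adj⇒toggle (false ∷ x) (true ∷ y)  eq = zero , cong (true ∷_) (sym (dist≡0⇒≡ x y (cong pred eq)))
Adj⇒toggle (true ∷ x)  (false ∷ y) eq = zero , cong (false ∷_) (sym (dist≡0⇒≡ x y (cong pred eq)))

lookup-ext : {x y : V n} → (∀ i → lookup x i ≡ lookup y i) → x ≡ y
lookup-ext {x = x} {y} eq = trans (sym (tabulate∘lookup x)) (trans (tabulate-cong eq) (tabulate∘lookup y))

lookup-ext-⟨$⟩ʳ : (σ : Permutation′ n) {x y : V n} →
  (∀ j → lookup x (σ ⟨$⟩ʳ j) ≡ lookup y (σ ⟨$⟩ʳ j)) → x ≡ y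
lookup-ext-⟨$⟩ʳ σ {x} {y} eq =
  lookup-ext λ i → subst (λ k → lookup x k ≡ lookup y k) (inverseʳ σ) (eq (σ ⟨$⟩ˡ i))

⟨$⟩ʳ-injective : (σ : Permutation′ n) → Injective _≡_ _≡_ (σ ⟨$⟩ʳ_)
⟨$⟩ʳ-injective σ eq = trans (sym (inverseˡ σ)) (trans (cong (σ ⟨$⟩ˡ_) eq) (inverseˡ σ))

lookup-act : (t : V n) (σ : Permutation′ n) (x : V n) (i : Fin n) →
  lookup (act (aut t σ) x) i ≡ lookup x (σ ⟨$⟩ˡ i) xor lookup t (σ ⟨$⟩ˡ i)
lookup-act t σ x i = trans (lookup∘tabulate _ i) (lookup-zipWith _xor_ (σ ⟨$⟩ˡ i) x t)

lookup-act-⟨$⟩ʳ : (t : V n) (σ : Permutation′ n) (x : V n) (j : Fin n) →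
  lookup (act (aut t σ) x) (σ ⟨$⟩ʳ j) ≡ lookup x j xor lookup t j
lookup-act-⟨$⟩ʳ t σ x j = trans (lookup-act t σ x _) (cong (λ i → lookup x i xor lookup t i) (inverseˡ σ))

act-toggle : (g : Aut n) (c : Fin n) (x : V n) → act g (toggle c x) ≡ toggle (Aut.perm g ⟨$⟩ʳ c) (act g x)
act-toggle (aut t σ) c x = lookup-ext-⟨$⟩ʳ σ at
  where
  open ≡-Reasoning
  g = aut t σ
  at : ∀ j → lookup (act g (toggle c x)) (σ ⟨$⟩ʳ j) ≡ lookup (toggle (σ ⟨$⟩ʳ c) (act g x)) (σ ⟨$⟩ʳ j)
  at j with j ≟ᶠ c
  ... | yes refl = begin
    lookup (act g (toggle j x)) (σ ⟨$⟩ʳ j)            ≡⟨ lookup-act-⟨$⟩ʳ t σ (toggle j x) j ⟩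
    lookup (toggle j x) j xor lookup t j              ≡⟨ cong (_xor lookup t j) (lookup-toggle j x) ⟩
    not (lookup x j) xor lookup t j                   ≡⟨ not-distribˡ-xor (lookup x j) (lookup t j) ⟨
    not (lookup x j xor lookup t j)                   ≡⟨ cong not (lookup-act-⟨$⟩ʳ t σ x j) ⟨
    not (lookup (act g x) (σ ⟨$⟩ʳ j))                  ≡⟨ lookup-toggle (σ ⟨$⟩ʳ j) (act g x) ⟨
    lookup (toggle (σ ⟨$⟩ʳ j) (act g x)) (σ ⟨$⟩ʳ j)    ∎
  ... | no j≢c = begin
    lookup (act g (toggle c x)) (σ ⟨$⟩ʳ j)            ≡⟨ lookup-act-⟨$⟩ʳ t σ (toggle c x) j ⟩
    lookup (toggle c x) j xor lookup t j              ≡⟨ cong (_xor lookup t j) (lookup-toggle-≢ x (j≢c ∘ sym)) ⟩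
    lookup x j xor lookup t j                         ≡⟨ lookup-act-⟨$⟩ʳ t σ x j ⟨
    lookup (act g x) (σ ⟨$⟩ʳ j)                        ≡⟨ lookup-toggle-≢ (act g x) (j≢c ∘ sym ∘ ⟨$⟩ʳ-injective σ) ⟨
    lookup (toggle (σ ⟨$⟩ʳ c) (act g x)) (σ ⟨$⟩ʳ j)    ∎

toggle-act : (g : Aut n) (a : Fin n) (x : V n) → toggle a (act g x) ≡ act g (toggle (Aut.perm g ⟨$⟩ˡ a) x)
toggle-act g a x = sym (trans (act-toggle g _ x) (cong (λ c → toggle c (act g x)) (inverseʳ (Aut.perm g))))

act-Adj : (g : Aut n) (x y : V n) → Adj x y → Adj (act g x) (act g y)
act-Adj g x _ x-y with c , refl ← Adj⇒toggle x _ x-y =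
  subst (Adj (act g x)) (sym (act-toggle g c x)) (toggle-Adj (Aut.perm g ⟨$⟩ʳ c) (act g x))

inverse : Aut n → Aut n
inverse (aut t σ) = aut (tabulate λ i → lookup t (σ ⟨$⟩ˡ i)) (σ ⁻¹ₚ)

xor-cancelʳ : ∀ a b → (a xor b) xor b ≡ a
xor-cancelʳ a b = trans (xor-assoc a b b) (trans (cong (a xor_) (xor-same b)) (xor-identityʳ a))

act-inverseˡ : (g : Aut n) (x : V n) → act (inverse g) (act g x) ≡ x
act-inverseˡ (aut t σ) x = lookup-ext-⟨$⟩ʳ (σ ⁻¹ₚ) λ j → begin
  lookup (act (inverse (aut t σ)) (act (aut t σ) x)) (σ ⟨$⟩ˡ j)
    ≡⟨ lookup-act-⟨$⟩ʳ _ (σ ⁻¹ₚ) (act (aut t σ) x) j ⟩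
  lookup (act (aut t σ) x) j xor lookup (tabulate λ i → lookup t (σ ⟨$⟩ˡ i)) j
    ≡⟨ cong₂ _xor_ (lookup-act t σ x j) (lookup∘tabulate _ j) ⟩
  (lookup x (σ ⟨$⟩ˡ j) xor lookup t (σ ⟨$⟩ˡ j)) xor lookup t (σ ⟨$⟩ˡ j)
    ≡⟨ xor-cancelʳ _ _ ⟩
  lookup x (σ ⟨$⟩ˡ j) ∎
  where open ≡-Reasoning

act-injective : (g : Aut n) {x y : V n} → act g x ≡ act g y → x ≡ y
act-injective g {x} {y} eq = trans (sym (act-inverseˡ g x)) (trans (cong (act (inverse g)) eq) (act-inverseˡ g y))

act-inverseʳ : (g : Aut n) (y : V n) → act g (act (inverse g) y) ≡ y
act-inverseʳ g y = act-injective (inverse g) (act-inverseˡ g (act (inverse g) y))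

_∙_ : Aut n → Aut n → Aut n
aut t₁ σ₁ ∙ aut t₂ σ₂ = aut (tabulate λ j → lookup t₁ j xor lookup t₂ (σ₁ ⟨$⟩ʳ j)) (σ₁ ∘ₚ σ₂)

act-∙ : (a b : Aut n) (x : V n) → act (a ∙ b) x ≡ act b (act a x)
act-∙ (aut t₁ σ₁) (aut t₂ σ₂) x = lookup-ext-⟨$⟩ʳ (σ₁ ∘ₚ σ₂) λ j → begin
  lookup (act (aut t₁ σ₁ ∙ aut t₂ σ₂) x) (σ₂ ⟨$⟩ʳ (σ₁ ⟨$⟩ʳ j))
    ≡⟨ lookup-act-⟨$⟩ʳ _ (σ₁ ∘ₚ σ₂) x j ⟩
  lookup x j xor lookup (tabulate λ j → lookup t₁ j xor lookup t₂ (σ₁ ⟨$⟩ʳ j)) j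
    ≡⟨ cong (lookup x j xor_) (lookup∘tabulate _ j) ⟩
  lookup x j xor (lookup t₁ j xor lookup t₂ (σ₁ ⟨$⟩ʳ j))
    ≡⟨ xor-assoc (lookup x j) (lookup t₁ j) _ ⟨
  (lookup x j xor lookup t₁ j) xor lookup t₂ (σ₁ ⟨$⟩ʳ j)
    ≡⟨ cong (_xor lookup t₂ (σ₁ ⟨$⟩ʳ j)) (lookup-act-⟨$⟩ʳ t₁ σ₁ x j) ⟨
  lookup (act (aut t₁ σ₁) x) (σ₁ ⟨$⟩ʳ j) xor lookup t₂ (σ₁ ⟨$⟩ʳ j)
    ≡⟨ lookup-act-⟨$⟩ʳ t₂ σ₂ (act (aut t₁ σ₁) x) (σ₁ ⟨$⟩ʳ j) ⟨
  lookup (act (aut t₂ σ₂) (act (aut t₁ σ₁) x)) (σ₂ ⟨$⟩ʳ (σ₁ ⟨$⟩ʳ j)) ∎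
  where open ≡-Reasoning

aut-through : V n → Permutation′ n → Aut n
aut-through y τ = aut (tabulate λ c → lookup y (τ ⟨$⟩ʳ c)) τ

act-aut-through : (y : V n) (τ : Permutation′ n) → act (aut-through y τ) origin ≡ y
act-aut-through y τ = lookup-ext-⟨$⟩ʳ τ λ j → begin
  lookup (act (aut-through y τ) origin) (τ ⟨$⟩ʳ j)
    ≡⟨ lookup-act-⟨$⟩ʳ _ τ origin j ⟩
  lookup origin j xor lookup (tabulate λ c → lookup y (τ ⟨$⟩ʳ c)) j
    ≡⟨ cong₂ _xor_ (lookup-replicate j false) (lookup∘tabulate _ j) ⟩
  lookup y (τ ⟨$⟩ʳ j) ∎
  where open ≡-Reasoning

module _ (S : Subgroup n) where

  ∼-refl : (x : V n) → x ∼[ S ] x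
  ∼-refl x = let e , e∈S , e-id = has-id S in e , e∈S , e-id x

  ∼-sym : {x y : V n} → x ∼[ S ] y → y ∼[ S ] x
  ∼-sym {x} (k , k∈S , refl) = let k⁻ , k⁻∈S , k⁻k = has-inv S k∈S in k⁻ , k⁻∈S , k⁻k x

  ∼-trans : {x y z : V n} → x ∼[ S ] y → y ∼[ S ] z → x ∼[ S ] z
  ∼-trans {x} (a , a∈S , refl) (b , b∈S , refl) = let c , c∈S , c≗ab = has-mul S a∈S b∈S in c , c∈S , c≗ab x

  ∼-lift-Adj : {a b y : V n} → a ∼[ S ] y → Adj a b → Σ (Fin n) λ e → b ∼[ S ] toggle e y
  ∼-lift-Adj {a} (m , m∈S , refl) a-b with c , refl ← Adj⇒toggle a _ a-b =
    Aut.perm m ⟨$⟩ʳ c , m , m∈S , act-toggle m c a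

orbit-setoid : Subgroup n → Setoid 0ℓ 0ℓ
orbit-setoid {n} S = record
  { Carrier = V n
  ; _≈_ = _∼[ S ]_
  ; isEquivalence = record { refl = λ {x} → ∼-refl S x ; sym = λ {x} {y} → ∼-sym S {x} {y}
                           ; trans = λ {x} {y} {z} → ∼-trans S {x} {y} {z} }
  }

module OrbitReasoning {n} (S : Subgroup n) = SetoidReasoning (orbit-setoid S)

-- Rigid subgroups

dK≥-mono : (K : Subgroup n) {m m′ : ℕ} → m ≤ m′ → dK≥ K m′ → dK≥ K m
dK≥-mono K m≤m′ dK k k∈K k≠1 x = ≤-trans m≤m′ (dK k k∈K k≠1 x)

dK≥⇒orbit-separated : (K : Subgroup n) {m : ℕ} → dK≥ K m → {x y : V n} → x ∼[ K ] y → dist x y < m → x ≡ y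
dK≥⇒orbit-separated K dK {x} (k , k∈K , refl) close with ≡-dec _≟ᵇ_ x (act k x)
... | yes x≡kx = x≡kx
... | no x≢kx = contradiction (dK k k∈K (λ k≡1 → x≢kx (sym (k≡1 x))) x) (<⇒≱ close)

-- The part of d_S ≥ 3 that the argument uses: no nontrivial element moves a vertex by 0 or 2 toggles.
Rigid : Subgroup n → Set
Rigid S = ∀ m → mem S m → ∀ x a b → act m x ≡ toggle a (toggle b x) → IsId m

dK≥⇒Rigid : (K : Subgroup n) → dK≥ K 3 → Rigid K
dK≥⇒Rigid K dK m m∈K x a b mx≡abx y with ≡-dec _≟ᵇ_ (act m y) y
... | yes my≡y = my≡y
... | no my≢y = contradiction (subst (3 ≤_) (cong (dist x) mx≡abx) (dK m m∈K (λ m≡1 → my≢y (m≡1 y)) x))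
                             (<⇒≱ (s≤s (dist-flips [] (a ∷ b ∷ []) x)))

Rigid⇒agree : (S : Subgroup n) → Rigid S → {s s′ : Aut n} → mem S s → mem S s′ →
  ∀ {x a b} → act s′ x ≡ toggle a (toggle b (act s x)) → s′ ≈ s
Rigid⇒agree S rigid {s} {s′} s∈S s′∈S {x} {a} {b} s′x≡ y
  with s⁻ , s⁻∈S , s⁻s ← has-inv S s∈S
  with m , m∈S , m≗ ← has-mul S s′∈S s⁻∈S = act-injective s⁻ (begin
    act s⁻ (act s′ y)  ≡⟨ m≗ y ⟨
    act m y            ≡⟨ m-id y ⟩
    y                  ≡⟨ s⁻s y ⟨
    act s⁻ (act s y)   ∎)
  where
  open ≡-Reasoning
  m-id : IsId m
  m-id = rigid m m∈S x _ _ (begin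
    act m x                                        ≡⟨ m≗ x ⟩
    act s⁻ (act s′ x)                              ≡⟨ cong (act s⁻) s′x≡ ⟩
    act s⁻ (toggle a (toggle b (act s x)))         ≡⟨ act-toggle s⁻ a (toggle b (act s x)) ⟩
    toggle _ (act s⁻ (toggle b (act s x)))         ≡⟨ cong (toggle _) (act-toggle s⁻ b (act s x)) ⟩
    toggle _ (toggle _ (act s⁻ (act s x)))         ≡⟨ cong (toggle _ ∘ toggle _) (s⁻s x) ⟩
    toggle _ (toggle _ x)                          ∎)

-- The member matching F at the origin keeps matching along every edge, by Rigid⇒agree.
orbit-preserving⇒member : (S : Subgroup n) → Rigid S → (F : V n → V n) →
  (∀ x y → Adj x y → Adj (F x) (F y)) → (∀ x → x ∼[ S ] F x) →
  Σ (Aut n) λ s → mem S s × (∀ x → act s x ≡ F x)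
orbit-preserving⇒member S rigid F F-Adj F-orbit with s , s∈S , s₀≡F₀ ← F-orbit origin =
  s , s∈S , toggle-induction (λ x → act s x ≡ F x) s₀≡F₀ step
  where
  step : ∀ c x → act s x ≡ F x → act s (toggle c x) ≡ F (toggle c x)
  step c x sx≡Fx with e , Fx′≡ ← Adj⇒toggle (F x) (F (toggle c x)) (F-Adj x (toggle c x) (toggle-Adj c x))
                    | s′ , s′∈S , s′x′≡Fx′ ← F-orbit (toggle c x) =
    trans (sym (Rigid⇒agree S rigid s∈S s′∈S {x = x′} s′x′≡ x′)) s′x′≡Fx′
    where
    open ≡-Reasoning
    x′ = toggle c x
    s′x′≡ : act s′ x′ ≡ toggle e (toggle (Aut.perm s ⟨$⟩ʳ c) (act s x′))
    s′x′≡ = begin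
      act s′ x′                                    ≡⟨ s′x′≡Fx′ ⟩
      F x′                                         ≡⟨ Fx′≡ ⟩
      toggle e (F x)                               ≡⟨ cong (toggle e) sx≡Fx ⟨
      toggle e (act s x)                           ≡⟨ cong (toggle e ∘ act s) (toggle-involutive c x) ⟨
      toggle e (act s (toggle c x′))               ≡⟨ cong (toggle e) (act-toggle s c x′) ⟩
      toggle e (toggle (Aut.perm s ⟨$⟩ʳ c) (act s x′)) ∎

-- h = g⁻¹ k g, read in the right action: (x ^ k) ^ g = (x ^ g) ^ h
Conjugates : Aut n → Aut n → Aut n → Set
Conjugates g k h = ∀ x → act g (act k x) ≡ act h (act g x)

Rigid-transport : (K L : Subgroup n) (g : Aut n) → Rigid K →
  (∀ h → mem L h → Σ (Aut n) λ k → mem K k × Conjugates g k h) → Rigid L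
Rigid-transport K L g rigidK from-L m m∈L x a b mx≡ w with k , k∈K , gk≡mg ← from-L m m∈L = begin
    act m w                            ≡⟨ cong (act m) (act-inverseʳ g w) ⟨
    act m (act g (act (inverse g) w))  ≡⟨ gk≡mg (act (inverse g) w) ⟨
    act g (act k (act (inverse g) w))  ≡⟨ cong (act g) (k-id (act (inverse g) w)) ⟩
    act g (act (inverse g) w)          ≡⟨ act-inverseʳ g w ⟩
    w                                  ∎
  where
  open ≡-Reasoning
  x₀ = act (inverse g) x
  σ = Aut.perm g
  k-id : IsId k
  k-id = rigidK k k∈K x₀ (σ ⟨$⟩ˡ a) (σ ⟨$⟩ˡ b) (act-injective g (begin
    act g (act k x₀)                                ≡⟨ gk≡mg x₀ ⟩
    act m (act g x₀)                                ≡⟨ cong (act m) (act-inverseʳ g x) ⟩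
    act m x                                         ≡⟨ mx≡ ⟩
    toggle a (toggle b x)                           ≡⟨ cong (toggle a ∘ toggle b) (act-inverseʳ g x) ⟨
    toggle a (toggle b (act g x₀))                  ≡⟨ cong (toggle a) (toggle-act g b x₀) ⟩
    toggle a (act g (toggle (σ ⟨$⟩ˡ b) x₀))         ≡⟨ toggle-act g a (toggle (σ ⟨$⟩ˡ b) x₀) ⟩
    act g (toggle (σ ⟨$⟩ˡ a) (toggle (σ ⟨$⟩ˡ b) x₀)) ∎))

-- Automorphisms carrying K-orbits onto L-orbits

OrbitEquivariant : Aut n → Subgroup n → Subgroup n → Set
OrbitEquivariant g K L = ∀ x y → (x ∼[ K ] y) ⇔ (act g x ∼[ L ] act g y)

Conj⇒orbit-equivariant : (g : Aut n) (K L : Subgroup n) → Conj g K L → OrbitEquivariant g K L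
Conj⇒orbit-equivariant g K L conj x y = mk⇔ (push {x} {y}) pull
  where
  push : ∀ {x y} → x ∼[ K ] y → act g x ∼[ L ] act g y
  push {x} (k , k∈K , refl) = h , Equivalence.from (conj h) (k , k∈K , λ z → sym (h-act z)) , h-act x
    where
    h = inverse g ∙ (k ∙ g)
    h-act : ∀ z → act h (act g z) ≡ act g (act k z)
    h-act z = begin
      act (inverse g ∙ (k ∙ g)) (act g z)      ≡⟨ act-∙ (inverse g) (k ∙ g) (act g z) ⟩
      act (k ∙ g) (act (inverse g) (act g z))  ≡⟨ act-∙ k g (act (inverse g) (act g z)) ⟩
      act g (act k (act (inverse g) (act g z))) ≡⟨ cong (act g ∘ act k) (act-inverseˡ g z) ⟩
      act g (act k z)                           ∎
      where open ≡-Reasoning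
  pull : act g x ∼[ L ] act g y → x ∼[ K ] y
  pull (h , h∈L , hgx≡gy) = let k , k∈K , gk≡hg = Equivalence.to (conj h) h∈L in
    k , k∈K , act-injective g (trans (gk≡hg x) hgx≡gy)

orbit-equivariant⇒QIso : (g : Aut n) (K L : Subgroup n) → OrbitEquivariant g K L → QIso K L
orbit-equivariant⇒QIso g K L equi = record
  { φ    = act g
  ; resp = λ {x} {y} → push x y
  ; inj  = λ {x} {y} → pull x y
  ; surj = λ y → act (inverse g) y , subst (_∼[ L ] y) (sym (act-inverseʳ g y)) (∼-refl L y)
  ; adj  = λ x y → mk⇔ (QAdj-push x y) (QAdj-pull x y)
  }
  where
  push = λ x y → Equivalence.to (equi x y)
  pull = λ x y → Equivalence.from (equi x y)
  pull⁻¹ : ∀ x a → act g x ∼[ L ] a → x ∼[ K ] act (inverse g) a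
  pull⁻¹ x a gx∼a = pull x _ (subst (act g x ∼[ L ]_) (sym (act-inverseʳ g a)) gx∼a)
  QAdj-push : ∀ x y → QAdj K x y → QAdj L (act g x) (act g y)
  QAdj-push x y (x≁y , a , b , x∼a , y∼b , a-b) =
    x≁y ∘ pull x y , act g a , act g b , push x a x∼a , push y b y∼b , act-Adj g a b a-b
  QAdj-pull : ∀ x y → QAdj L (act g x) (act g y) → QAdj K x y
  QAdj-pull x y (gx≁gy , a , b , gx∼a , gy∼b , a-b) =
    gx≁gy ∘ push x y , act (inverse g) a , act (inverse g) b ,
    pull⁻¹ x a gx∼a , pull⁻¹ y b gy∼b , act-Adj (inverse g) a b a-b

orbit-equivariant⇒Conj : (g : Aut n) (K L : Subgroup n) → Rigid K → OrbitEquivariant g K L → Conj g K L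
orbit-equivariant⇒Conj {n} g K L rigidK equi h = mk⇔ (from-L h) (from-K h)
  where
  from-L : ∀ h → mem L h → Σ (Aut n) λ k → mem K k × Conjugates g k h
  from-L h h∈L = let k , k∈K , k≗F = orbit-preserving⇒member K rigidK F F-Adj F-orbit in
    k , k∈K , λ x → trans (cong (act g) (k≗F x)) (act-inverseʳ g _)
    where
    F : V n → V n
    F x = act (inverse g) (act h (act g x))
    F-Adj : ∀ x y → Adj x y → Adj (F x) (F y)
    F-Adj x y = act-Adj (inverse g) (act h (act g x)) (act h (act g y))
              ∘ act-Adj h (act g x) (act g y) ∘ act-Adj g x y
    F-orbit : ∀ x → x ∼[ K ] F x
    F-orbit x = Equivalence.from (equi x (F x))
      (subst (act g x ∼[ L ]_) (sym (act-inverseʳ g _)) (h , h∈L , refl))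
  from-K : ∀ h → Σ (Aut n) (λ k → mem K k × Conjugates g k h) → mem L h
  from-K h (k , k∈K , gk≡hg) =
    let l , l∈L , l≗h = orbit-preserving⇒member L rigidL (act h) (act-Adj h) h-orbit in mem-resp L l≗h l∈L
    where
    rigidL : Rigid L
    rigidL = Rigid-transport K L g rigidK from-L
    h-orbit : ∀ y → y ∼[ L ] act h y
    h-orbit y = subst₂ _∼[ L ]_ (act-inverseʳ g y) (trans (gk≡hg x) (cong (act h) (act-inverseʳ g y)))
      (Equivalence.to (equi x (act k x)) (k , k∈K , refl))
      where x = act (inverse g) y

-- The automorphism induced by a quotient isomorphism

injective⇒surjective : {f : Fin n → Fin n} → Injective _≡_ _≡_ f → ∀ y → Σ (Fin n) λ i → f i ≡ y
injective⇒surjective {f = f} f-inj y with any? (λ i → f i ≟ᶠ y)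
... | yes hit = hit
injective⇒surjective {suc m} {f} f-inj y | no miss =
  contradiction (λ {i} {j} eq → f-inj (punchOut-injective (missed i) (missed j) eq)) (<⇒notInjective (n<1+n m))
  where
  missed : ∀ i → y ≢ f i
  missed i y≡fi = miss (i , sym y≡fi)

injective⇒permutation : {f : Fin n → Fin n} → Injective _≡_ _≡_ f → Permutation′ n
injective⇒permutation {f = f} f-inj =
  permutation f (proj₁ ∘ preimage) (proj₂ ∘ preimage) (λ i → f-inj (proj₂ (preimage (f i))))
  where preimage = injective⇒surjective f-inj

module InducedAutomorphism {n} {K L : Subgroup n} (dK : dK≥ K 5) (ψ : QIso K L) where
  open OrbitReasoning L

  _↦_ : V n → V n → Set
  x ↦ y = φ ψ x ∼[ L ] y

  K-close⇒≡ : {x x′ : V n} → x ∼[ K ] x′ → dist x x′ ≤ 4 → x ≡ x′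
  K-close⇒≡ x∼x′ close = dK≥⇒orbit-separated K dK x∼x′ (s≤s close)

  toggle-K-injective : {c c′ : Fin n} {x : V n} → toggle c x ∼[ K ] toggle c′ x → c ≡ c′
  toggle-K-injective {c} {c′} {x} cx∼c′x =
    toggle-injective x (K-close⇒≡ cx∼c′x (≤-trans (dist-flips (c ∷ []) (c′ ∷ []) x) (m≤m+n 2 2)))

  ↦-source : (x x′ : V n) {y : V n} → x ↦ y → x′ ↦ y → x ∼[ K ] x′
  ↦-source x x′ {y} x↦y x′↦y = inj ψ {x} {x′} (begin φ ψ x ≈⟨ x↦y ⟩ y ≈⟨ x′↦y ⟨ φ ψ x′ ∎)

  ↦-target : {x y y′ : V n} → x ↦ y → x ↦ y′ → y ∼[ L ] y′
  ↦-target {x} {y} {y′} x↦y x↦y′ = begin y ≈⟨ x↦y ⟨ φ ψ x ≈⟨ x↦y′ ⟩ y′ ∎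

  ↦-toggle : {x y : V n} → x ↦ y → ∀ c → Σ (Fin n) λ e → toggle c x ↦ toggle e y
  ↦-toggle {x} {y} x↦y c =
    let _ , a , b , φx∼a , φcx∼b , a-b = Equivalence.to (adj ψ x (toggle c x)) x≃cx
        e , b∼ey = ∼-lift-Adj L {a} {b} {y} (begin a ≈⟨ φx∼a ⟨ φ ψ x ≈⟨ x↦y ⟩ y ∎) a-b
    in e , (begin φ ψ (toggle c x) ≈⟨ φcx∼b ⟩ b ≈⟨ b∼ey ⟩ toggle e y ∎)
    where
    x≃cx : QAdj K x (toggle c x)
    x≃cx = (λ x∼cx → toggle-≢ c x (sym (K-close⇒≡ x∼cx (≤-trans (dist-flips [] (c ∷ []) x) (m≤m+n 1 3))))) ,
           x , toggle c x , ∼-refl K x , ∼-refl K (toggle c x) , toggle-Adj c x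

  module Neighbours {x y : V n} (x↦y : x ↦ y) where

    match : Fin n → Fin n
    match c = proj₁ (↦-toggle x↦y c)

    toggle-match : ∀ c → toggle c x ↦ toggle (match c) y
    toggle-match c = proj₂ (↦-toggle x↦y c)

    match-injective : Injective _≡_ _≡_ match
    match-injective {c} {c′} mc≡mc′ = toggle-K-injective (↦-source (toggle c x) (toggle c′ x)
      (toggle-match c) (subst (λ e → toggle c′ x ↦ toggle e y) (sym mc≡mc′) (toggle-match c′)))

    match-perm : Permutation′ n
    match-perm = injective⇒permutation match-injective

    ↦-toggle-onto : ∀ e → Σ (Fin n) λ c → toggle c x ↦ toggle e y
    ↦-toggle-onto e = c , subst (λ e′ → toggle c x ↦ toggle e′ y) (inverseʳ match-perm) (toggle-match c)
      where c = match-perm ⟨$⟩ˡ e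

    toggle-L-injective : {e e′ : Fin n} → toggle e y ∼[ L ] toggle e′ y → e ≡ e′
    toggle-L-injective {e} {e′} ey∼e′y =
      let c  , cx↦ey   = ↦-toggle-onto e
          c′ , c′x↦e′y = ↦-toggle-onto e′
          c≡c′ = toggle-K-injective
                   (↦-source (toggle c x) (toggle c′ x) (∼-trans L {φ ψ (toggle c x)} cx↦ey ey∼e′y) c′x↦e′y)
      in trans (sym (inverseʳ match-perm)) (trans (cong (match-perm ⟨$⟩ʳ_) c≡c′) (inverseʳ match-perm))

  -- Both ways around the square end at vertices of one K-orbit at distance ≤ 4, which coincide.
  ↦-square : {x y : V n} {c c′ e e′ : Fin n} → x ↦ y → c ≢ c′ →
    toggle c x ↦ toggle e y → toggle c′ x ↦ toggle e′ y → toggle c′ (toggle c x) ↦ toggle e′ (toggle e y)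
  ↦-square {x} {y} {c} {c′} {e} {e′} x↦y c≢c′ cx↦ey c′x↦e′y =
    finish rcx↦ (toggle-pair-cases x c≢c′
      (K-close⇒≡ (↦-source (toggle s (toggle c′ x)) (toggle r (toggle c x)) sc′x↦ rcx↦)
                 (dist-flips (s ∷ c′ ∷ []) (r ∷ c ∷ []) x)))
    where
    r = proj₁ (Neighbours.↦-toggle-onto cx↦ey e′)
    rcx↦ : toggle r (toggle c x) ↦ toggle e′ (toggle e y)
    rcx↦ = proj₂ (Neighbours.↦-toggle-onto cx↦ey e′)
    s = proj₁ (Neighbours.↦-toggle-onto c′x↦e′y e)
    sc′x↦ : toggle s (toggle c′ x) ↦ toggle e′ (toggle e y)
    sc′x↦ = subst (toggle s (toggle c′ x) ↦_) (toggle-comm e e′ y) (proj₂ (Neighbours.↦-toggle-onto c′x↦e′y e))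
    finish : ∀ {r} → toggle r (toggle c x) ↦ toggle e′ (toggle e y) → r ≡ c ⊎ r ≡ c′ →
             toggle c′ (toggle c x) ↦ toggle e′ (toggle e y)
    finish c′cx↦ (inj₂ refl) = c′cx↦
    finish ccx↦ (inj₁ refl) =
      contradiction (toggle-K-injective (↦-source (toggle c x) (toggle c′ x) cx↦ey c′x↦ey)) c≢c′
      where
      x↦e′ey : x ↦ toggle e′ (toggle e y)
      x↦e′ey = subst (_↦ toggle e′ (toggle e y)) (toggle-involutive c x) ccx↦
      e≡e′ : e ≡ e′
      e≡e′ = Neighbours.toggle-L-injective cx↦ey
        (subst (_∼[ L ] toggle e′ (toggle e y)) (sym (toggle-involutive e y)) (↦-target x↦y x↦e′ey))
      c′x↦ey : toggle c′ x ↦ toggle e y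
      c′x↦ey = subst (λ e″ → toggle c′ x ↦ toggle e″ y) (sym e≡e′) c′x↦e′y

  open Neighbours (∼-refl L (φ ψ origin)) using (match-perm; toggle-match)

  g : Aut n
  g = aut-through (φ ψ origin) match-perm

  Tracks : V n → Set
  Tracks x = x ↦ act g x × (∀ c → toggle c x ↦ act g (toggle c x))

  tracks-origin : Tracks origin
  tracks-origin =
    subst (origin ↦_) (sym (act-aut-through (φ ψ origin) match-perm)) (∼-refl L (φ ψ origin)) ,
    λ c → subst (toggle c origin ↦_)
      (sym (trans (act-toggle g c origin) (cong (toggle (match-perm ⟨$⟩ʳ c)) (act-aut-through (φ ψ origin) match-perm))))
      (toggle-match c)

  tracks-toggle : ∀ c x → Tracks x → Tracks (toggle c x)
  tracks-toggle c x (x↦gx , nbrs) = nbrs c , λ c′ → at c′ (c′ ≟ᶠ c)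
    where
    moved : ∀ c → toggle c x ↦ toggle (match-perm ⟨$⟩ʳ c) (act g x)
    moved c = subst (toggle c x ↦_) (act-toggle g c x) (nbrs c)
    at : ∀ c′ → Dec (c′ ≡ c) → toggle c′ (toggle c x) ↦ act g (toggle c′ (toggle c x))
    at c′ (yes refl) = subst (λ v → v ↦ act g v) (sym (toggle-involutive c x)) x↦gx
    at c′ (no c′≢c) = subst (toggle c′ (toggle c x) ↦_)
      (sym (trans (act-toggle g c′ (toggle c x)) (cong (toggle (match-perm ⟨$⟩ʳ c′)) (act-toggle g c x))))
      (↦-square x↦gx (c′≢c ∘ sym) (moved c) (moved c′))

  tracks : ∀ x → x ↦ act g x
  tracks x = proj₁ (toggle-induction Tracks tracks-origin tracks-toggle x)

tracking-automorphism : (K L : Subgroup n) → dK≥ K 5 → (ψ : QIso K L) →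
  Σ (Aut n) λ g → ∀ x → φ ψ x ∼[ L ] act g x
tracking-automorphism K L dK ψ = InducedAutomorphism.g dK ψ , InducedAutomorphism.tracks dK ψ

tracking⇒orbit-equivariant : (K L : Subgroup n) (ψ : QIso K L) (g : Aut n) →
  (∀ x → φ ψ x ∼[ L ] act g x) → OrbitEquivariant g K L
tracking⇒orbit-equivariant K L ψ g tracks x y = mk⇔
  (λ x∼y → begin act g x ≈⟨ tracks x ⟨ φ ψ x ≈⟨ resp ψ {x} {y} x∼y ⟩ φ ψ y ≈⟨ tracks y ⟩ act g y ∎)
  (λ gx∼gy → inj ψ {x} {y} (begin φ ψ x ≈⟨ tracks x ⟩ act g x ≈⟨ gx∼gy ⟩ act g y ≈⟨ tracks y ⟨ φ ψ y ∎))
  where open OrbitReasoning L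

proposition3p9 : (n : ℕ) (K L : Subgroup n) →
    (dK≥ K 5 → (ψ : QIso K L) →
      Σ (Aut n) λ g → Conj g K L × (∀ x → φ ψ x ∼[ L ] act g x))
    ×
    ((g : Aut n) → Conj g K L →
      Σ (QIso K L) λ ψ → (∀ x → φ ψ x ∼[ L ] act g x))
proposition3p9 n K L = part-i , part-ii
  where
  part-i : dK≥ K 5 → (ψ : QIso K L) → Σ (Aut n) λ g → Conj g K L × (∀ x → φ ψ x ∼[ L ] act g x)
  part-i dK ψ =
    let g , tracks = tracking-automorphism K L dK ψ
        rigidK = dK≥⇒Rigid K (dK≥-mono K (m≤m+n 3 2) dK)
    in g , orbit-equivariant⇒Conj g K L rigidK (tracking⇒orbit-equivariant K L ψ g tracks) , tracks
  part-ii : (g : Aut n) → Conj g K L → Σ (QIso K L) λ ψ → (∀ x → φ ψ x ∼[ L ] act g x)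
  part-ii g conj = orbit-equivariant⇒QIso g K L (Conj⇒orbit-equivariant g K L conj) , λ x → ∼-refl L (act g x)
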